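{- Suppose that $\mathcal P_1(S_n \setminus \{1\}) \subseteq \mathcal D^{\mathrm{op}}$ and that there exists $i \in S_n \setminus \{1\}$ such that $\{i\} \in \mathcal D$ and $\varepsilon_i = \varepsilon_{ -i} = 1$. Then $p_i$ is a Fermat prime.
   Context: Standing setting: $n \ge 3$ is an integer, $S_n = \{1,\ldots,n\}$; for a set $X$, $\mathcal P_\star(X)$ is the family of finite nonempty proper subsets of $X$ and $\mathcal P_k(X)$ the family of $k$-element subsets. Let $p_1 < p_2 < \cdots < p_n$ be primes, $\mathfrak P = \{p_1,\ldots,p_n\}$, $v_1,\ldots,v_n$ positive integers, $\mathcal D$ a nonempty subfamily of $\mathcal P_\star(S_n)$, and $\varepsilon:\mathcal P_\star(S_n)\to\{\pm1\}$ a map, with $\varepsilon_I := \varepsilon(I)$. Standing hypothesis: every prime $q$ dividing $\prod_{i\in I} p_i^{v_i} - \varepsilon_I$ for some $I \in \mathcal D$ belongs to $\mathfrak P$. Notation: $\mathcal D^{\mathrm{op}} := \{S_n\setminus I : I \in \mathcal D\}$; for $i \in S_n$, $\varepsilon_i := \varepsilon(\{i\})$ and $\varepsilon_{ -i} := \varepsilon(S_n\setminus\{i\})$. A Fermat prime is a prime of the form $2^{2^m}+1$ with $m \ge 0$. -}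

module Defs where

open import Data.Nat using (ℕ; zero; suc; _^_; _+_; _*_; _<_)
open import Data.Nat.Primality using (Prime)
open import Data.Fin using (Fin)
open import Data.Fin.Subset using (Subset; _∈_; _∉_; Nonempty; ⊤; ∁; ⁅_⁆)
open import Data.Bool using (true; false)
open import Data.Vec using (Vec; []; _∷_)
open import Data.Integer using (ℤ; +_; _-_)
open import Data.Product using (∃; _×_)
open import Relation.Binary.PropositionalEquality using (_≡_; _≢_)
open import Relation.Nullary using (¬_)

-- Proper nonempty subsets of S_n (here S_n is modelled by Fin n).
ProperNonempty : ∀ {n} → Subset n → Set
ProperNonempty I = Nonempty I × I ≢ ⊤

prodOver : ∀ {n} → Subset n → (Fin n → ℕ) → ℕ
prodOver [] f = 1
prodOver (true ∷ I) f = f Fin.zero * prodOver I (λ i → f (Fin.suc i))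
prodOver (false ∷ I) f = prodOver I (λ i → f (Fin.suc i))

data PM : Set where
  plus minus : PM

toℤ : PM → ℤ
toℤ plus = + 1
toℤ minus = Data.Integer.-_ (+ 1)

FermatPrime : ℕ → Set
FermatPrime p = Prime p × ∃ λ m → p ≡ 2 ^ (2 ^ m) + 1

module Submission where

-- Put P = p_i (i ≠ 1), f(l) = p_l^{v_l} and M = ∏_{l ≠ i} f(l),
-- the product over S_n ∖ {i}.
--  (1) S_n ∖ {i} ∈ D with sign +1, so every prime factor of M − 1 is some p_j;
--      each p_j with j ≠ i divides M and hence not M − 1, so M − 1 = P^a.
--  (2) {i} ∈ D with sign +1, so every prime factor of P^{v_i} − 1 is some p_j.
--      A prime q ∣ P − 1 divides P^{v_i} − 1, hence q = p_j with j ≠ i (as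
--      q < P), so q divides M = P^a + 1 ≡ 2 (mod q): q = 2.
--  (3) Thus P − 1 = 2^m with m ≠ 0 (P > p_1 ≥ 2).  If m had an odd prime
--      factor r, m = w·r, then 2^w + 1 would be a proper divisor of 2^m + 1;
--      so m is a power of 2 and P is a Fermat prime.

open import Defs
open import Data.Nat using (ℕ; _^_; _<_; _≤_; _+_)
open import Data.Nat.Primality using (Prime)
open import Data.Fin using (Fin; zero; suc)
open import Data.Fin.Subset using (Subset; ⁅_⁆; ∁)
open import Data.Integer using (+_; _-_)
open import Data.Product using (∃)
open import Relation.Binary.PropositionalEquality using (_≡_; _≢_)

module Arithmetic where

  open import Data.Nat.Base
    using (zero; suc; _*_; _∸_; NonZero; nonTrivial⇒n>1; n>1⇒nonTrivial; ≢-nonZero; >-nonZero; s≤s; z≤n)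
  open import Data.Nat.Properties
  open import Data.Nat.Divisibility
  open import Data.Nat.Primality
    using (prime⇒nonTrivial; prime⇒irreducible; prime⇒¬composite; composite-≢)
  open import Data.Nat.Primality.Factorisation using (factorise; PrimeFactorisation)
  open import Data.Nat.ListAction using (product)
  open import Data.Nat.ListAction.Properties using (∈⇒∣product)
  open import Data.Nat.Tactic.RingSolver using (solve-∀)
  open import Data.List.Base using (List; []; _∷_; length)
  open import Data.List.Membership.Propositional using (_∈_)
  open import Data.List.Relation.Unary.Any using (here; there)
  import Data.List.Relation.Unary.All as All
  open import Data.Product using (_,_)
  open import Data.Sum using (_⊎_; inj₁; inj₂)
  open import Data.Empty using (⊥-elim)
  open import Function using (_∘_)
  open import Relation.Nullary using (¬_; yes; no)
  open import Relation.Binary.PropositionalEquality using (refl; sym; trans; cong; cong₂; subst; module ≡-Reasoning)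

  prime>1 : ∀ {q} → Prime q → 1 < q
  prime>1 {q} pq = nonTrivial⇒n>1 q {{prime⇒nonTrivial pq}}

  prime∤1 : ∀ {q} → Prime q → ¬ q ∣ 1
  prime∤1 pq q∣1 = <⇒≢ (prime>1 pq) (sym (∣1⇒≡1 q∣1))

  prime∤consecutive : ∀ {q x} → Prime q → q ∣ x → ¬ q ∣ suc x
  prime∤consecutive {q} {x} pq q∣x q∣1+x =
    prime∤1 pq (∣m+n∣m⇒∣n (subst (q ∣_) (+-comm 1 x) q∣1+x) q∣x)

  base∣power : ∀ m {v} → 1 ≤ v → m ∣ m ^ v
  base∣power m {suc w} _ = m∣m*n (m ^ w)

  product-of-copies : ∀ P (as : List ℕ) → (∀ {r} → r ∈ as → r ≡ P) → product as ≡ P ^ length as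
  product-of-copies P []       _ = refl
  product-of-copies P (a ∷ as) h = cong₂ _*_ (h (here refl)) (product-of-copies P as (h ∘ there))

  power-of-prime : ∀ x P → .{{NonZero x}} → (∀ r → Prime r → r ∣ x → r ≡ P) → ∃ λ a → x ≡ P ^ a
  power-of-prime x P only-P = length factors , trans x≡∏ (product-of-copies P factors factor≡P)
    where
    open PrimeFactorisation (factorise x) renaming (isFactorisation to x≡∏)
    factor≡P : ∀ {r} → r ∈ factors → r ≡ P
    factor≡P r∈ = only-P _ (All.lookup factorsPrime r∈) (subst (_ ∣_) (sym x≡∏) (∈⇒∣product r∈))

  power-of-one-mod : ∀ q s v → ∃ λ t → (1 + s * q) ^ v ≡ 1 + t * q
  power-of-one-mod q s zero = 0 , refl
  power-of-one-mod q s (suc v) with power-of-one-mod q s v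
  ... | t , bᵛ≡ = s + t + s * t * q , (begin
      (1 + s * q) * (1 + s * q) ^ v ≡⟨ cong ((1 + s * q) *_) bᵛ≡ ⟩
      (1 + s * q) * (1 + t * q)     ≡⟨ expand s t q ⟩
      1 + (s + t + s * t * q) * q   ∎)
    where
    open ≡-Reasoning
    expand : ∀ s t q → (1 + s * q) * (1 + t * q) ≡ 1 + (s + t + s * t * q) * q
    expand = solve-∀

  parity : ∀ n → ∃ λ h → n ≡ h + h ⊎ n ≡ suc (h + h)
  parity zero = 0 , inj₁ refl
  parity (suc n) with parity n
  ... | h , inj₁ even = h , inj₂ (cong suc even)
  ... | h , inj₂ odd  = suc h , inj₁ (trans (cong suc odd) (sym (cong suc (+-suc h h))))

  h+h≡h*2 : ∀ h → h + h ≡ h * 2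
  h+h≡h*2 = solve-∀

  odd-prime : ∀ {r} → Prime r → r ≢ 2 → ∃ λ c → r ≡ suc (c + c)
  odd-prime {r} pr r≢2 with parity r
  ... | h , inj₂ odd  = h , odd
  ... | h , inj₁ refl with prime⇒irreducible pr (divides h (h+h≡h*2 h))
  ... | inj₁ ()
  ... | inj₂ 2≡r = ⊥-elim (r≢2 (sym 2≡r))

  odd-power-divisible : ∀ x c → x + 1 ∣ x ^ suc (c + c) + 1
  odd-power-divisible zero    c       = 1∣ _
  odd-power-divisible (suc y) zero    = subst (λ z → suc y + 1 ∣ z + 1) (sym (*-identityʳ (suc y))) ∣-refl
  odd-power-divisible (suc y) (suc c) rewrite +-suc c c =
    ∣m+n∣m⇒∣n (subst (suc y + 1 ∣_) (step y (suc y ^ suc (c + c)))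
                      (∣n⇒∣m*n (suc y * suc y) (odd-power-divisible (suc y) c)))
              (n∣m*n y)
    where
    step : ∀ y A → (1 + y) * (1 + y) * (A + 1) ≡ y * ((1 + y) + 1) + ((1 + y) * ((1 + y) * A) + 1)
    step = solve-∀

  -- If w ≥ 1 and d = 2c + 1 ≥ 3, then 2^w + 1 is a proper divisor of 2^{wd} + 1.
  odd-factor⇒not-prime : ∀ w c → w ≢ 0 → c ≢ 0 → ¬ Prime (2 ^ (w * suc (c + c)) + 1)
  odd-factor⇒not-prime w c w≢0 c≢0 prime-2ʷᵈ+1 =
    prime⇒¬composite prime-2ʷᵈ+1 (composite-≢ (x + 1) {{nontrivial}} {{nonzero}} x+1≢ x+1∣)
    where
    x = 2 ^ w
    d = suc (c + c)
    x+1∣ : x + 1 ∣ 2 ^ (w * d) + 1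
    x+1∣ = subst (λ z → x + 1 ∣ z + 1) (^-*-assoc 2 w d) (odd-power-divisible x c)
    w<wd : w < w * d
    w<wd = subst (_< w * d) (*-identityʳ w)
                 (*-monoʳ-< w {{≢-nonZero w≢0}} (s≤s (≤-trans (n≢0⇒n>0 c≢0) (m≤m+n c c))))
    x+1≢ : x + 1 ≢ 2 ^ (w * d) + 1
    x+1≢ e = <⇒≢ (^-monoʳ-< 2 (s≤s (s≤s z≤n)) w<wd) (+-cancelʳ-≡ 1 x _ e)
    nontrivial = n>1⇒nonTrivial (+-monoˡ-< 1 (m^n>0 2 w))
    nonzero = >-nonZero (≤-trans (s≤s z≤n) (m≤n+m 1 (2 ^ (w * d))))

  fermat-exponent : ∀ m → m ≢ 0 → Prime (2 ^ m + 1) → ∃ λ e → m ≡ 2 ^ e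
  fermat-exponent m m≢0 prime-2ᵐ+1 = power-of-prime m 2 {{≢-nonZero m≢0}} only-two
    where
    only-two : ∀ r → Prime r → r ∣ m → r ≡ 2
    only-two r pr r∣m with r ≟ 2
    ... | yes r≡2 = r≡2
    ... | no  r≢2 with odd-prime pr r≢2 | r∣m
    ...   | c , refl | divides w m≡wr =
      ⊥-elim (odd-factor⇒not-prime w c (m≢0 ∘ w≡0⇒m≡0) (prime∤1 pr ∘ r≡1)
                                   (subst (λ z → Prime (2 ^ z + 1)) m≡wr prime-2ᵐ+1))
      where
      w≡0⇒m≡0 : w ≡ 0 → m ≡ 0
      w≡0⇒m≡0 refl = m≡wr
      r≡1 : c ≡ 0 → suc (c + c) ∣ 1
      r≡1 refl = ∣-refl

  fermat-criterion : ∀ {P} → Prime P → 2 < P → (∀ q → Prime q → q ∣ P ∸ 1 → q ≡ 2) → FermatPrime P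
  fermat-criterion {suc Q@(suc (suc _))} prime-P (s≤s (s≤s (s≤s _))) only-two
    with power-of-prime Q 2 only-two
  ... | zero      , ()
  ... | m@(suc _) , Q≡2ᵐ =
    prime-P , fermat-form (fermat-exponent m (λ ()) (subst Prime P≡2ᵐ+1 prime-P))
    where
    P≡2ᵐ+1 : suc Q ≡ 2 ^ m + 1
    P≡2ᵐ+1 = trans (cong suc Q≡2ᵐ) (+-comm 1 (2 ^ m))
    fermat-form : (∃ λ e → m ≡ 2 ^ e) → ∃ λ e → suc Q ≡ 2 ^ (2 ^ e) + 1
    fermat-form (e , m≡2ᵉ) = e , trans P≡2ᵐ+1 (cong (λ z → 2 ^ z + 1) m≡2ᵉ)

  ∣pred⇒∣pred-power : ∀ {q P} v → 0 < P → q ∣ P ∸ 1 → q ∣ P ^ v ∸ 1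
  ∣pred⇒∣pred-power {q} {suc P′} v _ (divides s P′≡sq) with power-of-one-mod q s v
  ... | t , Pᵛ≡ = divides t (cong (_∸ 1) (trans (cong (λ z → suc z ^ v) P′≡sq) Pᵛ≡))

module Products where

  open import Data.Nat.Base using (zero; suc; _*_; s≤s; z≤n)
  open import Data.Nat.Properties using (*-identityʳ; *-mono-<)
  open import Data.Nat.Divisibility using (_∣_; m∣m*n; ∣n⇒∣m*n)
  open import Data.Fin.Subset using (_∈_) renaming (⊥ to ∅)
  open import Data.Vec using ([]; _∷_; here; there)
  open import Data.Bool using (true; false)
  open import Relation.Binary.PropositionalEquality using (refl; trans; cong)

  prodOver-∅ : ∀ n (f : Fin n → ℕ) → prodOver (∅ {n}) f ≡ 1
  prodOver-∅ zero    f = refl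
  prodOver-∅ (suc n) f = prodOver-∅ n (λ l → f (suc l))

  prodOver-⁅⁆ : ∀ {n} (i : Fin n) (f : Fin n → ℕ) → prodOver ⁅ i ⁆ f ≡ f i
  prodOver-⁅⁆ {suc n} zero    f = trans (cong (f zero *_) (prodOver-∅ n (λ l → f (suc l)))) (*-identityʳ (f zero))
  prodOver-⁅⁆         (suc i) f = prodOver-⁅⁆ i (λ l → f (suc l))

  ∣-prodOver : ∀ {n} (I : Subset n) (f : Fin n → ℕ) {x} → x ∈ I → f x ∣ prodOver I f
  ∣-prodOver (true  ∷ I) f here         = m∣m*n _
  ∣-prodOver (true  ∷ I) f (there x∈I) = ∣n⇒∣m*n (f zero) (∣-prodOver I (λ l → f (suc l)) x∈I)
  ∣-prodOver (false ∷ I) f (there x∈I) = ∣-prodOver I (λ l → f (suc l)) x∈I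

  prodOver-pos : ∀ {n} (I : Subset n) (f : Fin n → ℕ) → (∀ x → 0 < f x) → 0 < prodOver I f
  prodOver-pos []          f f>0 = s≤s z≤n
  prodOver-pos (true  ∷ I) f f>0 = *-mono-< (f>0 zero) (prodOver-pos I _ (λ l → f>0 (suc l)))
  prodOver-pos (false ∷ I) f f>0 = prodOver-pos I _ (λ l → f>0 (suc l))

module PrimeFamilies where

  open Arithmetic
  open Products
  open import Data.Nat.Base using (suc; _∸_; ≢-nonZero; >-nonZero; z<s)
  open import Data.Nat.Properties using (≤-antisym; <⇒≤; <⇒≱; +-comm; ∸-monoʳ-<; m<n⇒0<n∸m; m^n>0)
  open import Data.Nat.Divisibility using (_∣_; ∣-trans; ∣m+n∣m⇒∣n; ∣⇒≤)
  open import Data.Fin using (_≟_)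
  open import Data.Fin.Subset.Properties using (x∉p⇒x∈∁p; x≢y⇒x∉⁅y⁆)
  import Data.Integer.Divisibility as ℤ
  open import Data.Product using (_,_; map₂)
  open import Data.Empty using (⊥-elim)
  open import Relation.Nullary using (yes; no)
  open import Relation.Binary.PropositionalEquality using (refl; trans; cong; subst)

  PrimeDivisorsAmong : ∀ {n} → (Fin n → ℕ) → ℕ → Set
  PrimeDivisorsAmong p y = ∀ q → Prime q → q ∣ y → ∃ λ j → q ≡ p j

  -- For a sign ε_I = +1 the hypothesis on ℤ is a statement about x − 1 in ℕ.
  pred-divisor⇒ℤ : ∀ x → 0 < x → ∀ q → q ∣ x ∸ 1 → (+ q) ℤ.∣ ((+ x) - toℤ plus)
  pred-divisor⇒ℤ (suc y) _ q q∣y = q∣y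

  base∣complement-product : ∀ {n} (p v : Fin n → ℕ) → (∀ l → 1 ≤ v l) →
    ∀ i j → j ≢ i → p j ∣ prodOver (∁ ⁅ i ⁆) (λ l → p l ^ v l)
  base∣complement-product p v v≥1 i j j≢i =
    ∣-trans (base∣power (p j) (v≥1 j)) (∣-prodOver (∁ ⁅ i ⁆) _ (x∉p⇒x∈∁p (x≢y⇒x∉⁅y⁆ j≢i)))

  pred-is-power : ∀ {n} (p : Fin n → ℕ) → (∀ j → Prime (p j)) → ∀ i j₀ → j₀ ≢ i →
    ∀ x → 0 < x → (∀ j → j ≢ i → p j ∣ x) → PrimeDivisorsAmong p (x ∸ 1) →
    ∃ λ a → x ≡ suc (p i ^ a)
  pred-is-power p pr i j₀ j₀≢i (suc y) _ p∣x y-factors =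
    map₂ (cong suc) (power-of-prime y (p i) {{≢-nonZero y≢0}} only-pᵢ)
    where
    y≢0 : y ≢ 0
    y≢0 refl = prime∤1 (pr j₀) (p∣x j₀ j₀≢i)
    only-pᵢ : ∀ r → Prime r → r ∣ y → r ≡ p i
    only-pᵢ r pr-r r∣y with y-factors r pr-r r∣y
    ... | j , refl with j ≟ i
    ...   | yes refl = refl
    ...   | no  j≢i  = ⊥-elim (prime∤consecutive pr-r r∣y (p∣x j j≢i))

  -- Step (2): let P = p_i > 1, let every prime factor of P^v − 1 be some p_j,
  -- and let every p_j with j ≠ i divide x = P^a + 1.  A prime q ∣ P − 1 is
  -- then some p_j with j ≠ i, and q ∣ x − (P^a − 1) = 2.
  pred-factors-are-two : ∀ {n} (p : Fin n → ℕ) i v a x → 1 < p i →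
    PrimeDivisorsAmong p (p i ^ v ∸ 1) → (∀ j → j ≢ i → p j ∣ x) → x ≡ suc (p i ^ a) →
    ∀ q → Prime q → q ∣ p i ∸ 1 → q ≡ 2
  pred-factors-are-two p i v a x 1<P Pᵛ-factors p∣x x≡Pᵃ+1 q pq q∣P-1
    with Pᵛ-factors q pq (∣pred⇒∣pred-power v (<⇒≤ 1<P) q∣P-1)
  ... | j , refl with j ≟ i
  ...   | yes refl =
    ⊥-elim (<⇒≱ (∸-monoʳ-< z<s (<⇒≤ 1<P)) (∣⇒≤ {{>-nonZero (m<n⇒0<n∸m 1<P)}} q∣P-1))
  ...   | no  j≢i  = ≤-antisym (∣⇒≤ q∣2) (prime>1 pq)
    where
    x≡ : x ≡ (p i ^ a ∸ 1) + 2
    x≡ = trans x≡Pᵃ+1 (suc≡pred+2 (m^n>0 (p i) {{>-nonZero (<⇒≤ 1<P)}} a))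
      where
      suc≡pred+2 : ∀ {y} → 0 < y → suc y ≡ (y ∸ 1) + 2
      suc≡pred+2 {suc y} _ = +-comm 2 y
    q∣2 : p j ∣ 2
    q∣2 = ∣m+n∣m⇒∣n (subst (p j ∣_) x≡ (p∣x j j≢i)) (∣pred⇒∣pred-power a (<⇒≤ 1<P) q∣P-1)

open Arithmetic using (prime>1; fermat-criterion)
open Products using (prodOver-⁅⁆; prodOver-pos)
open PrimeFamilies
open import Data.Nat using (_∸_; z≤n)
open import Data.Nat.Properties using (≤-<-trans; <-trans; n<1+n; m^n>0)
open import Data.Nat.Primality using (prime⇒nonZero)
open import Data.Fin.Properties using (≤∧≢⇒<)
open import Data.Product using (proj₁; proj₂)
open import Function using (_∘_)
open import Relation.Binary.PropositionalEquality using (sym; subst)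
open import Data.Integer.Divisibility using (_∣_)

lemma5 : (k : ℕ) →
    (p : Fin (3 + k) → ℕ) → (∀ i → Prime (p i)) →
    (∀ {i j : Fin (3 + k)} → Data.Fin._<_ i j → p i < p j) →
    (v : Fin (3 + k) → ℕ) → (∀ i → 1 ≤ v i) →
    (D : Subset (3 + k) → Set) → (∀ I → D I → ProperNonempty I) → (∃ λ I → D I) →
    (ε : Subset (3 + k) → PM) →
    (∀ I → D I → ∀ (q : ℕ) → Prime q →
    (+ q) ∣ ((+ prodOver I (λ i → p i ^ v i)) - toℤ (ε I)) →
    ∃ λ j → q ≡ p j) →
    (∀ (j : Fin (3 + k)) → j ≢ zero → D (∁ ⁅ j ⁆)) →
    (i : Fin (3 + k)) → i ≢ zero → D ⁅ i ⁆ → ε ⁅ i ⁆ ≡ plus → ε (∁ ⁅ i ⁆) ≡ plus →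
    FermatPrime (p i)
lemma5 k p pr mono v v≥1 D _ _ ε H Dc i i≢0 Di εi εci =
  fermat-criterion (pr i) 2<P
    (pred-factors-are-two p i (v i) (proj₁ M-power) M (<-trans (n<1+n 1) 2<P)
      Pᵛ-1-factors (base∣complement-product p v v≥1 i) (proj₂ M-power))
  where
  f : Fin (3 + k) → ℕ
  f l = p l ^ v l
  M : ℕ
  M = prodOver (∁ ⁅ i ⁆) f
  f>0 : ∀ l → 0 < f l
  f>0 l = m^n>0 (p l) {{prime⇒nonZero (pr l)}} (v l)
  admissible : ∀ I → D I → ε I ≡ plus → PrimeDivisorsAmong p (prodOver I f ∸ 1)
  admissible I I∈D εI≡+ q pq q∣ =
    H I I∈D q pq (subst (λ e → (+ q) ∣ ((+ prodOver I f) - toℤ e)) (sym εI≡+)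
                   (pred-divisor⇒ℤ _ (prodOver-pos I f f>0) q q∣))
  -- p_i > p_1 ≥ 2
  2<P : 2 < p i
  2<P = ≤-<-trans (prime>1 (pr zero)) (mono (≤∧≢⇒< z≤n (i≢0 ∘ sym)))
  M-power : ∃ λ a → M ≡ 1 + p i ^ a
  M-power = pred-is-power p pr i zero (i≢0 ∘ sym) M (prodOver-pos (∁ ⁅ i ⁆) f f>0)
              (base∣complement-product p v v≥1 i) (admissible (∁ ⁅ i ⁆) (Dc i i≢0) εci)
  Pᵛ-1-factors : PrimeDivisorsAmong p (p i ^ v i ∸ 1)
  Pᵛ-1-factors = subst (λ x → PrimeDivisorsAmong p (x ∸ 1)) (prodOver-⁅⁆ i f) (admissible ⁅ i ⁆ Di εi)
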